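{- Let $T$ be a tournament of order $n\ge 2$. Then $\gamma_{os}(T)\le\lceil\log_2 n\rceil$.
   Context: A tournament is an orientation of a complete graph. For a digraph $D=(V,A)$ with underlying graph $G$ (vertices $u,v$ adjacent iff $uv\in A$ or $vu\in A$), $S\subseteq V$ is dominating in $G$ if every vertex outside $S$ has a neighbor in $S$. $S$ is an out-secure dominating set (OSDS) of $D$ if $S$ is dominating in $G$ and for every $v\in V\setminus S$ there is an in-neighbor $u\in S$ of $v$ such that $(S\setminus\{u\})\cup\{v\}$ is dominating in $G$; $\gamma_{os}(D)$ is the minimum size of an OSDS. -}

module Defs where

open import Data.Nat using (ℕ)
open import Data.Fin using (Fin)
open import Data.Fin.Subset using (Subset; _∈_; _∉_; _∪_; _-_; ⁅_⁆)
open import Data.Product using (Σ; _×_; ∃-syntax)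
open import Data.Sum using (_⊎_)
open import Relation.Nullary using (¬_)
open import Relation.Binary.PropositionalEquality using (_≡_)

-- A digraph on vertex set Fin n, given by its arc relation:
-- Arc u v means (u , v) ∈ A.
Digraph : ℕ → Set₁
Digraph n = Fin n → Fin n → Set

record IsTournament {n : ℕ} (D : Digraph n) : Set where
  field
    irreflexive : ∀ u → ¬ D u u
    total       : ∀ u v → ¬ u ≡ v → D u v ⊎ D v u
    antisym     : ∀ u v → D u v → ¬ D v u

Adj : {n : ℕ} → Digraph n → Fin n → Fin n → Set
Adj D u v = D u v ⊎ D v u

Dominating : {n : ℕ} → Digraph n → Subset n → Set
Dominating {n} D S = ∀ (v : Fin n) → v ∉ S → ∃[ u ] (u ∈ S × Adj D u v)

IsOSDS : {n : ℕ} → Digraph n → Subset n → Set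
IsOSDS {n} D S =
  Dominating D S ×
  (∀ (v : Fin n) → v ∉ S →
     ∃[ u ] (u ∈ S × D u v × Dominating D ((S - u) ∪ ⁅ v ⁆)))

-- In a tournament any set containing a vertex dominates the underlying complete graph, and
-- (S - u) ∪ ⁅ v ⁆ always contains v; so an out-secure dominating set is simply a nonempty set
-- S such that every vertex outside S has an in-neighbour in S. Such a set is built greedily:
-- the in-degrees inside a set W of m vertices sum to at most m(m-1)/2, so a vertex of minimum
-- in-degree has fewer than m/2 in-neighbours in W; it joins S and the construction continues
-- on those in-neighbours, so each step halves what remains to be dominated.
module Submission where

open import Defs
open import Data.Nat using (ℕ; _≤_)
open import Data.Nat.Logarithm using (⌈log₂_⌉)
open import Data.Fin.Subset using (Subset; ∣_∣)
open import Data.Product using (_×_; ∃-syntax)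

open import Data.Nat using (suc; _+_; _*_; _^_; _<_; z≤n; s≤s; ⌊_/2⌋; ⌈_/2⌉; pred; >-nonZero)
open import Data.Nat.Properties hiding (_≟_)
open import Algebra.Properties.CommutativeSemigroup +-commutativeSemigroup using (x∙yz≈y∙xz)
open import Data.Nat.Induction using (<-rec)
open import Data.Nat.ListAction using (sum)
open import Data.Nat.Logarithm using (⌈log₂⌉-mono-≤; ⌈log₂⌈n/2⌉⌉≡⌈log₂n⌉∸1)
open import Data.Nat.Solver using (module +-*-Solver)
open import Data.Fin using (Fin; _≟_; fromℕ<)
open import Data.Fin.Subset using (_∈_; _∉_; _∪_; _-_; ⁅_⁆; inside; outside) renaming (⊥ to ∅)
open import Data.Fin.Subset.Properties using (x∈⁅x⁆; p⊆p∪q; q⊆p∪q; ∣⊥∣≡0; ∣⁅x⁆∣≡1)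
open import Data.Vec using ([]; _∷_)
open import Data.List using (List; []; _∷_; length; map; filter; allFin)
open import Data.List.Properties using (length-tabulate; filter-reject)
open import Data.List.Relation.Unary.All using (All; []; _∷_)
open import Data.List.Relation.Unary.Any using (here; there)
open import Data.List.Membership.Propositional using () renaming (_∈_ to _∈ₗ_)
open import Data.List.Membership.Propositional.Properties using (∈-filter⁺; ∈-allFin)
open import Data.List.Extrema.Nat using (argmin; f[argmin]≤f[⊤]; f[argmin]≤f[xs])
open import Data.Product using (_,_; proj₂)
open import Data.Sum using (_⊎_; inj₁; inj₂)
open import Data.Empty using (⊥-elim)
open import Function using (id)
open import Relation.Nullary using (Dec; yes; no)
open import Relation.Binary.PropositionalEquality using (_≡_; refl; sym; trans; cong; cong₂; subst)

open ≤-Reasoning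

∣p∪q∣≤∣p∣+∣q∣ : ∀ {n} (p q : Subset n) → ∣ p ∪ q ∣ ≤ ∣ p ∣ + ∣ q ∣
∣p∪q∣≤∣p∣+∣q∣ []            []            = z≤n
∣p∪q∣≤∣p∣+∣q∣ (outside ∷ p) (outside ∷ q) = ∣p∪q∣≤∣p∣+∣q∣ p q
∣p∪q∣≤∣p∣+∣q∣ (outside ∷ p) (inside ∷ q)  =
  ≤-trans (s≤s (∣p∪q∣≤∣p∣+∣q∣ p q)) (≤-reflexive (sym (+-suc ∣ p ∣ ∣ q ∣)))
∣p∪q∣≤∣p∣+∣q∣ (inside ∷ p)  (outside ∷ q) = s≤s (∣p∪q∣≤∣p∣+∣q∣ p q)
∣p∪q∣≤∣p∣+∣q∣ (inside ∷ p)  (inside ∷ q)  =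
  s≤s (≤-trans (∣p∪q∣≤∣p∣+∣q∣ p q) (+-monoʳ-≤ ∣ p ∣ (n≤1+n ∣ q ∣)))

fromList : ∀ {n} → List (Fin n) → Subset n
fromList []      = ∅
fromList (u ∷ S) = ⁅ u ⁆ ∪ fromList S

∈-fromList⁺ : ∀ {n} {u : Fin n} {S} → u ∈ₗ S → u ∈ fromList S
∈-fromList⁺ {S = v ∷ S} (here refl)  = p⊆p∪q (fromList S) (x∈⁅x⁆ v)
∈-fromList⁺ {S = v ∷ S} (there u∈S) = q⊆p∪q ⁅ v ⁆ (fromList S) (∈-fromList⁺ u∈S)

∣fromList∣≤length : ∀ {n} (S : List (Fin n)) → ∣ fromList S ∣ ≤ length S
∣fromList∣≤length {n} [] = ≤-reflexive (∣⊥∣≡0 n)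
∣fromList∣≤length (u ∷ S) = begin
  ∣ ⁅ u ⁆ ∪ fromList S ∣       ≤⟨ ∣p∪q∣≤∣p∣+∣q∣ ⁅ u ⁆ (fromList S) ⟩
  ∣ ⁅ u ⁆ ∣ + ∣ fromList S ∣   ≡⟨ cong (_+ ∣ fromList S ∣) (∣⁅x⁆∣≡1 u) ⟩
  suc ∣ fromList S ∣           ≤⟨ s≤s (∣fromList∣≤length S) ⟩
  suc (length S)               ∎

⌈log₂n⌉≡1+⌈log₂⌈n/2⌉⌉ : ∀ {n} → 2 ≤ n → ⌈log₂ n ⌉ ≡ suc ⌈log₂ ⌈ n /2⌉ ⌉
⌈log₂n⌉≡1+⌈log₂⌈n/2⌉⌉ {n} 2≤n = begin-equality
  ⌈log₂ n ⌉                ≡⟨ suc-pred ⌈log₂ n ⌉ {{>-nonZero (⌈log₂⌉-mono-≤ 2≤n)}} ⟨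
  suc (pred ⌈log₂ n ⌉)     ≡⟨ cong suc (⌈log₂⌈n/2⌉⌉≡⌈log₂n⌉∸1 n) ⟨
  suc ⌈log₂ ⌈ n /2⌉ ⌉      ∎

n≤2^⌈log₂n⌉ : ∀ n → n ≤ 2 ^ ⌈log₂ n ⌉
n≤2^⌈log₂n⌉ = <-rec (λ n → n ≤ 2 ^ ⌈log₂ n ⌉) bound
  where
  bound : ∀ n → (∀ {m} → m < n → m ≤ 2 ^ ⌈log₂ m ⌉) → n ≤ 2 ^ ⌈log₂ n ⌉
  bound 0 _ = z≤n
  bound 1 _ = s≤s z≤n
  bound n@(suc (suc m)) rec = begin
    n                                      ≡⟨ ⌊n/2⌋+⌈n/2⌉≡n n ⟨
    ⌊ n /2⌋ + ⌈ n /2⌉                      ≤⟨ +-monoˡ-≤ ⌈ n /2⌉ (⌊n/2⌋≤⌈n/2⌉ n) ⟩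
    ⌈ n /2⌉ + ⌈ n /2⌉                      ≤⟨ +-mono-≤ half≤ half≤ ⟩
    2 ^ k + 2 ^ k                          ≡⟨ cong (2 ^ k +_) (+-identityʳ (2 ^ k)) ⟨
    2 ^ suc k                              ≡⟨ cong (2 ^_) (⌈log₂n⌉≡1+⌈log₂⌈n/2⌉⌉ {n} (s≤s (s≤s z≤n))) ⟨
    2 ^ ⌈log₂ n ⌉                          ∎
    where
    k = ⌈log₂ ⌈ n /2⌉ ⌉
    half≤ : ⌈ n /2⌉ ≤ 2 ^ k
    half≤ = rec (⌈n/2⌉<n m)

length*≤sum : ∀ {A : Set} (f : A → ℕ) {c W} → All (λ w → c ≤ f w) W → length W * c ≤ sum (map f W)
length*≤sum f []           = z≤n
length*≤sum f (c≤fw ∷ c≤f) = +-mono-≤ c≤fw (length*≤sum f c≤f)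

length*min≤sum : ∀ {A : Set} (f : A → ℕ) x W →
  length (x ∷ W) * f (argmin f x W) ≤ sum (map f (x ∷ W))
length*min≤sum f x W = length*≤sum f (f[argmin]≤f[⊤] {f = f} x W ∷ f[argmin]≤f[xs] {f = f} x W)

module Tournament {n : ℕ} {T : Digraph n} (tournament : IsTournament T) where
  open IsTournament tournament

  trichotomy : ∀ u v → u ≡ v ⊎ T u v ⊎ T v u
  trichotomy u v with u ≟ v
  ... | yes u≡v = inj₁ u≡v
  ... | no  u≢v = inj₂ (total u v u≢v)

  arc? : ∀ u v → Dec (T u v)
  arc? u v with trichotomy u v
  ... | inj₁ refl       = no (irreflexive u)
  ... | inj₂ (inj₁ uv) = yes uv
  ... | inj₂ (inj₂ vu) = no (antisym v u vu)

  inNeighbours : Fin n → List (Fin n) → List (Fin n)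
  inNeighbours v = filter (λ w → arc? w v)

  indegree : List (Fin n) → Fin n → ℕ
  indegree W v = length (inNeighbours v W)

  outdegree : List (Fin n) → Fin n → ℕ
  outdegree W u = length (filter (arc? u) W)

  -- The number of arcs inside W, counted over pairs of positions of W.
  arcCount : List (Fin n) → ℕ
  arcCount W = sum (map (indegree W) W)

  indegree+outdegree≤length : ∀ W u → indegree W u + outdegree W u ≤ length W
  indegree+outdegree≤length []      u = z≤n
  indegree+outdegree≤length (w ∷ W) u with arc? w u | arc? u w | indegree+outdegree≤length W u
  ... | yes wu | yes uw | _  = ⊥-elim (antisym w u wu uw)
  ... | yes _  | no _   | ih = s≤s ih
  ... | no _   | yes _  | ih = ≤-trans (≤-reflexive (+-suc _ _)) (s≤s ih)
  ... | no _   | no _   | ih = m≤n⇒m≤1+n ih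

  sum-indegree-∷ : ∀ x W U →
    sum (map (indegree (x ∷ W)) U) ≡ outdegree U x + sum (map (indegree W) U)
  sum-indegree-∷ x W []      = refl
  sum-indegree-∷ x W (v ∷ U)
    with exchange ← trans (cong (indegree W v +_) (sum-indegree-∷ x W U))
                          (x∙yz≈y∙xz (indegree W v) (outdegree U x) _)
       | arc? x v
  ... | yes _ = cong suc exchange
  ... | no  _ = exchange

  arcCount-∷ : ∀ x W → arcCount (x ∷ W) ≡ (indegree W x + outdegree W x) + arcCount W
  arcCount-∷ x W = begin-equality
    indegree (x ∷ W) x + sum (map (indegree (x ∷ W)) W)
      ≡⟨ cong₂ _+_ (cong length (filter-reject (λ w → arc? w x) (irreflexive x)))
                   (sum-indegree-∷ x W W) ⟩
    indegree W x + (outdegree W x + arcCount W)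
      ≡⟨ +-assoc (indegree W x) (outdegree W x) (arcCount W) ⟨
    (indegree W x + outdegree W x) + arcCount W
      ∎

  2*arcCount+length≤length² : ∀ W → 2 * arcCount W + length W ≤ length W * length W
  2*arcCount+length≤length² []      = z≤n
  2*arcCount+length≤length² (x ∷ W) = begin
    2 * arcCount (x ∷ W) + suc M
      ≡⟨ cong (λ a → 2 * a + suc M) (arcCount-∷ x W) ⟩
    2 * ((indegree W x + outdegree W x) + arcCount W) + suc M
      ≤⟨ +-monoˡ-≤ (suc M) (*-monoʳ-≤ 2 (+-monoˡ-≤ (arcCount W) (indegree+outdegree≤length W x))) ⟩
    2 * (M + arcCount W) + suc M
      ≡⟨ solve 2 (λ m a → con 2 :* (m :+ a) :+ (con 1 :+ m)
                        := (con 2 :* a :+ m) :+ (con 1 :+ (m :+ m))) refl M (arcCount W) ⟩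
    (2 * arcCount W + M) + suc (M + M)
      ≤⟨ +-monoˡ-≤ (suc (M + M)) (2*arcCount+length≤length² W) ⟩
    M * M + suc (M + M)
      ≡⟨ solve 1 (λ m → m :* m :+ (con 1 :+ (m :+ m)) := (con 1 :+ m) :* (con 1 :+ m)) refl M ⟩
    suc M * suc M
      ∎
    where
    open +-*-Solver
    M = length W

  ∃-2*indegree<length : ∀ x W → ∃[ v ] 2 * indegree (x ∷ W) v < length (x ∷ W)
  ∃-2*indegree<length x W = v , *-cancelˡ-≤ M (begin
    M * suc (2 * r)
      ≡⟨ solve 2 (λ m r → m :* (con 1 :+ con 2 :* r) := con 2 :* (m :* r) :+ m) refl M r ⟩
    2 * (M * r) + M
      ≤⟨ +-monoˡ-≤ M (*-monoʳ-≤ 2 (length*min≤sum (indegree (x ∷ W)) x W)) ⟩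
    2 * arcCount (x ∷ W) + M
      ≤⟨ 2*arcCount+length≤length² (x ∷ W) ⟩
    M * M
      ∎)
    where
    open +-*-Solver
    v = argmin (indegree (x ∷ W)) x W
    M = length (x ∷ W)
    r = indegree (x ∷ W) v

  _OutDominates_ : List (Fin n) → List (Fin n) → Set
  S OutDominates W = ∀ {w} → w ∈ₗ W → w ∈ₗ S ⊎ ∃[ u ] (u ∈ₗ S × T u w)

  ∷-outDominates : ∀ {v S W} → S OutDominates inNeighbours v W → (v ∷ S) OutDominates W
  ∷-outDominates {v} dom {w} w∈W with trichotomy w v
  ... | inj₁ refl       = inj₁ (here refl)
  ... | inj₂ (inj₂ vw) = inj₂ (v , here refl , vw)
  ... | inj₂ (inj₁ wv) with dom (∈-filter⁺ (λ u → arc? u v) w∈W wv)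
  ...   | inj₁ w∈S            = inj₁ (there w∈S)
  ...   | inj₂ (u , u∈S , uw) = inj₂ (u , there u∈S , uw)

  mutual
    outDominator< : ∀ k W → length W < 2 ^ k → ∃[ S ] (length S ≤ k × S OutDominates W)
    outDominator< k       []      _          = [] , z≤n , λ ()
    outDominator< 0       (_ ∷ _) (s≤s ())
    outDominator< (suc k) W       |W|<2^1+k = outDominator≤ k W (<⇒≤ |W|<2^1+k)

    outDominator≤ : ∀ k W → length W ≤ 2 ^ suc k → ∃[ S ] (length S ≤ suc k × S OutDominates W)
    outDominator≤ k []      _          = [] , z≤n , λ ()
    outDominator≤ k (x ∷ W) |W|≤2^1+k =
      let v , 2r<|W|      = ∃-2*indegree<length x W
          S , |S|≤k , dom = outDominator< k (inNeighbours v (x ∷ W))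
                              (*-cancelˡ-< 2 _ _ (<-≤-trans 2r<|W| |W|≤2^1+k))
      in v ∷ S , s≤s |S|≤k , ∷-outDominates dom

  nonempty-dominating : ∀ {S u} → u ∈ S → Dominating T S
  nonempty-dominating {u = u} u∈S v v∉S = u , u∈S , total u v λ { refl → v∉S u∈S }

  nonempty-outDominating⇒OSDS : ∀ {S u} → u ∈ S → (∀ v → v ∉ S → ∃[ w ] (w ∈ S × T w v)) →
    IsOSDS T S
  nonempty-outDominating⇒OSDS {S} u∈S outDom = nonempty-dominating u∈S , secure
    where
    secure : ∀ v → v ∉ S → ∃[ w ] (w ∈ S × T w v × Dominating T ((S - w) ∪ ⁅ v ⁆))
    secure v v∉S with outDom v v∉S
    ... | w , w∈S , wv = w , w∈S , wv , nonempty-dominating (q⊆p∪q (S - w) ⁅ v ⁆ (x∈⁅x⁆ v))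

  fromList-isOSDS : ∀ {S} → S OutDominates allFin n → Fin n → IsOSDS T (fromList S)
  fromList-isOSDS {S} dom u = nonempty-outDominating⇒OSDS (∈-fromList⁺ (proj₂ member)) outDom
    where
    member : ∃[ w ] w ∈ₗ S
    member with dom (∈-allFin u)
    ... | inj₁ u∈S          = u , u∈S
    ... | inj₂ (w , w∈S , _) = w , w∈S
    outDom : ∀ v → v ∉ fromList S → ∃[ w ] (w ∈ fromList S × T w v)
    outDom v v∉S with dom (∈-allFin v)
    ... | inj₁ v∈S           = ⊥-elim (v∉S (∈-fromList⁺ v∈S))
    ... | inj₂ (w , w∈S , wv) = w , ∈-fromList⁺ w∈S , wv

  ∃-OSDS-≤ : ∀ k → n ≤ 2 ^ suc k → Fin n → ∃[ S ] (IsOSDS T S × ∣ S ∣ ≤ suc k)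
  ∃-OSDS-≤ k n≤2^1+k u =
    let S , |S|≤1+k , dom = outDominator≤ k (allFin n)
                              (≤-trans (≤-reflexive (length-tabulate id)) n≤2^1+k)
    in fromList S , fromList-isOSDS dom u , ≤-trans (∣fromList∣≤length S) |S|≤1+k

proposition3p15 : (n : ℕ) → 2 ≤ n → (T : Digraph n) → IsTournament T →
    ∃[ S ] (IsOSDS T S × ∣ S ∣ ≤ ⌈log₂ n ⌉)
proposition3p15 n 2≤n T tournament =
  subst (λ L → ∃[ S ] (IsOSDS T S × ∣ S ∣ ≤ L)) (sym ⌈log₂n⌉≡1+k)
    (∃-OSDS-≤ k n≤2^1+k (fromℕ< 2≤n))
  where
  open Tournament tournament
  k = ⌈log₂ ⌈ n /2⌉ ⌉
  ⌈log₂n⌉≡1+k : ⌈log₂ n ⌉ ≡ suc k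
  ⌈log₂n⌉≡1+k = ⌈log₂n⌉≡1+⌈log₂⌈n/2⌉⌉ 2≤n
  n≤2^1+k : n ≤ 2 ^ suc k
  n≤2^1+k = ≤-trans (n≤2^⌈log₂n⌉ n) (≤-reflexive (cong (2 ^_) ⌈log₂n⌉≡1+k))
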